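{- Let $M$ be a matroid and let $R$ be a round flat of $M$. Then $\operatorname{tw}(M)\geq r(R)$.
   Context: A vertical cover of a matroid $N$ is a pair $(F,F')$ of flats of $N$, neither equal to $E(N)$, with $F\cup F'=E(N)$; a flat $R$ of $M$ is round if $M|R$ has no vertical cover. A tree-decomposition of $M$ is a pair $(T,\tau)$ with $T$ a tree and $\tau:V(T)\to\mathcal{P}(E(M))$ such that every element of $E(M)$ lies in $\tau(t)$ for at least one node $t$. For a node $t$ with $T-t$ having components $T_1,\dots,T_d$ and $F_i=\bigcup_{s\in V(T_i)}\tau(s)$, the node-width of $t$ is $\sum_{i=1}^{d} r\big(\tau(t)\cup\bigcup_{k\neq i}F_k\big)-(d-1)r(M)$; the width of $(T,\tau)$ is the maximum node-width, and the tree-width $\operatorname{tw}(M)$ is the minimum width over all tree-decompositions of $M$. -}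

module Defs where

open import Data.Nat as ℕ using (ℕ; zero; suc; _≤_; _<_; _+_)
open import Data.Integer as ℤ using (ℤ; +_)
open import Data.Fin using (Fin; zero; suc; toℕ; _≟_)
open import Data.Fin.Subset using (Subset; _∪_; _∩_; _⊆_; _∈_; _∉_; ⁅_⁆; ⋃; ⊤; ∣_∣)
open import Data.List as List using (List; []; _∷_; _++_; map; filter; allFin; length; removeAt; foldr)
open import Data.Nat.ListAction using (sum)
import Data.List.Membership.DecPropositional as DecMem
open import Data.Product using (Σ; ∃; _×_; _,_)
open import Relation.Binary.PropositionalEquality using (_≡_; _≢_)
open import Relation.Nullary using (¬_)

record Matroid (n : ℕ) : Set where
  field
    rank        : Subset n → ℕ
    rank-bound  : ∀ X → rank X ≤ ∣ X ∣
    rank-mono   : ∀ {X Y} → X ⊆ Y → rank X ≤ rank Y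
    rank-submod : ∀ X Y → rank (X ∪ Y) + rank (X ∩ Y) ≤ rank X + rank Y

module _ {n : ℕ} (M : Matroid n) where
  open Matroid M

  r[M] : ℕ
  r[M] = rank ⊤

  -- F is a flat of the restriction M|R : F ⊆ R and F is closed in M|R,
  -- i.e. no element e ∈ R - F lies in the closure of F (r(F ∪ e) = r(F)).
  IsFlatIn : Subset n → Subset n → Set
  IsFlatIn R F = F ⊆ R × (∀ e → e ∈ R → e ∉ F → rank (F ∪ ⁅ e ⁆) ≢ rank F)

  IsFlat : Subset n → Set
  IsFlat F = IsFlatIn ⊤ F

  VerticalCoverIn : Subset n → Subset n → Subset n → Set
  VerticalCoverIn R F F' =
    IsFlatIn R F × IsFlatIn R F' × F ≢ R × F' ≢ R × (F ∪ F') ≡ R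

  IsRoundFlat : Subset n → Set
  IsRoundFlat R = IsFlat R × ¬ (Σ (Subset n) λ F → Σ (Subset n) λ F' → VerticalCoverIn R F F')

-- The tree T has node set
-- Fin (suc m); node 0 is a root and node (suc i) has parent (parent i),
-- which has smaller index (so T is a tree; every finite tree arises this way
-- up to isomorphism).
record TreeDecomposition (n : ℕ) : Set where
  field
    m         : ℕ
    parent    : Fin m → Fin (suc m)
    parent-lt : ∀ i → toℕ (parent i) ≤ toℕ i
    τ         : Fin (suc m) → Subset n
    covers    : ∀ e → ∃ λ t → e ∈ τ t

  Node : Set
  Node = Fin (suc m)

  open DecMem (_≟_ {suc m}) using () renaming (_∈?_ to _∈L?_; _∉?_ to _∉L?_)

  -- the path from s up to the root (s, parent s, ..., 0); fuel m suffices
  ancestorsF : ℕ → Node → List Node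
  ancestorsF zero    s       = s ∷ []
  ancestorsF (suc f) zero    = zero ∷ []
  ancestorsF (suc f) (suc i) = suc i ∷ ancestorsF f (parent i)

  ancestors : Node → List Node
  ancestors = ancestorsF m

  nodes : List Node
  nodes = allFin (suc m)

  children : Node → List Node
  children t = map suc (filter (λ i → parent i ≟ t) (allFin m))

  subtree : Node → List Node
  subtree c = filter (λ s → c ∈L? ancestors s) nodes

  upper : Node → List Node
  upper t = filter (λ s → t ∉L? ancestors s) nodes

  -- the vertex sets of the components of T - t
  components : Node → List (List Node)
  components zero    = map subtree (children zero)
  components (suc i) = map subtree (children (suc i)) ++ (upper (suc i) ∷ [])

  bags : Node → List (Subset n)
  bags t = map (λ C → ⋃ (map τ C)) (components t)

module _ {n : ℕ} (M : Matroid n) (D : TreeDecomposition n) where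
  open Matroid M
  open TreeDecomposition D

  nodeWidth : Node → ℤ
  nodeWidth t =
    (+ sum (map (λ i → rank (τ t ∪ ⋃ (removeAt (bags t) i))) (allFin (length (bags t)))))
    ℤ.- ((+ length (bags t) ℤ.- + 1) ℤ.* + r[M] M)

  width : ℤ
  width = foldr (λ t w → nodeWidth t ℤ.⊔ w) (nodeWidth zero) nodes

-- Call a node t of the tree-decomposition spanning if the elements in the bags
-- of the subtree below t span R; the root is spanning, so there is a spanning
-- node t none of whose children is spanning.  Roundness of R says that if
-- A ∪ B = E(M) and A does not span R, then B does; hence, for every component
-- C of T - t, the set Xᶜ = τ(t) ∪ ⋃ (bags of the other components) spans R.
-- Peeling the components off one at a time, submodularity then gives
--   r(τ(t) ∪ R) + d·r(M) ≤ Σ_C r(Xᶜ) + r(M),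
-- i.e. the node-width of t is at least r(τ(t) ∪ R) ≥ r(R).
module Submission where

open import Defs
open import Data.Nat using (ℕ)
open import Data.Integer using (+_; _≤_)
open import Data.Fin.Subset using (Subset)

open import Level using (Level)
open import Function using (_∘_)
open import Data.Empty using (⊥-elim)
open import Data.Product using (∃; _×_; _,_; proj₁; proj₂)
open import Data.Sum using (inj₁; inj₂; [_,_]′) renaming (map to ⊎-map)
open import Data.Nat as ℕ using (zero; suc; _+_; _*_; _≤?_; s≤s)
import Data.Nat.Properties as ℕ
open import Data.Nat.ListAction using (sum)
open import Data.Integer as ℤ using (+≤+)
import Data.Integer.Properties as ℤ
open import Data.Integer.Tactic.RingSolver using (solve-∀)
open import Data.Fin as Fin using (Fin; zero; suc; toℕ; fromℕ<; _≟_)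
import Data.Fin.Properties as Fin
open import Data.Fin.Subset using (_∪_; _∩_; _⊆_; _∈_; ⁅_⁆; ⋃; ⊤)
open import Data.Fin.Subset.Properties
  using (_∈?_; x∈p∪q⁺; x∈p∪q⁻; x∈p∩q⁺; ∈⊤; ∉⊥; ⊆-refl; ⊆-trans; ⊆-antisym; x∈⁅x⁆; x∈⁅y⁆⇒x≡y; ∪-assoc)
open import Data.List using (List; []; _∷_; map; filter; allFin; removeAt; length; foldr; tabulate)
open import Data.List.Relation.Unary.Any using (here; there)
open import Data.List.Membership.Propositional renaming (_∈_ to _∈ₗ_; _∉_ to _∉ₗ_)
open import Data.List.Membership.Propositional.Properties
  using (∈-filter⁺; ∈-filter⁻; ∈-allFin; ∈-map⁺; ∈-map⁻; ∈-++⁺ˡ; ∈-++⁺ʳ; ∈-++⁻)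
import Data.List.Membership.DecPropositional as DecMembership
import Data.List.Properties as List
import Data.Vec as Vec
open import Data.Vec.Properties using (lookup∘tabulate; lookup⇒[]=; []=⇒lookup)
open import Relation.Binary.PropositionalEquality
open import Relation.Nullary using (¬_; Dec; yes; no; does; _×-dec_)
open import Relation.Nullary.Decidable using (dec-true)
open import Relation.Unary using (Pred; Decidable)

private variable
  ℓ : Level
  A : Set ℓ
  n : ℕ
  p q r : Subset n
  x : Fin n

∪-lub : p ⊆ r → q ⊆ r → p ∪ q ⊆ r
∪-lub {p = p} {q = q} p⊆r q⊆r x∈p∪q = [ p⊆r , q⊆r ]′ (x∈p∪q⁻ p q x∈p∪q)

⊆-∪ˡ : p ⊆ q → p ⊆ q ∪ r
⊆-∪ˡ p⊆q x∈p = x∈p∪q⁺ (inj₁ (p⊆q x∈p))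

⊆-∪ʳ : p ⊆ r → p ⊆ q ∪ r
⊆-∪ʳ p⊆r x∈p = x∈p∪q⁺ (inj₂ (p⊆r x∈p))

∈-⋃⁺ : ∀ {ps : List (Subset n)} → x ∈ p → p ∈ₗ ps → x ∈ ⋃ ps
∈-⋃⁺ x∈p (here refl) = x∈p∪q⁺ (inj₁ x∈p)
∈-⋃⁺ x∈p (there p∈ps) = x∈p∪q⁺ (inj₂ (∈-⋃⁺ x∈p p∈ps))

∈-⋃⁻ : ∀ (ps : List (Subset n)) → x ∈ ⋃ ps → ∃ λ p → p ∈ₗ ps × x ∈ p
∈-⋃⁻ [] x∈⊥ = ⊥-elim (∉⊥ x∈⊥)
∈-⋃⁻ (p ∷ ps) x∈⋃ with x∈p∪q⁻ p (⋃ ps) x∈⋃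
... | inj₁ x∈p = p , here refl , x∈p
... | inj₂ x∈⋃ps with ∈-⋃⁻ ps x∈⋃ps
...   | p′ , p′∈ps , x∈p′ = p′ , there p′∈ps , x∈p′

⋃-removeAt-map : ∀ (f : A → Subset n) xs (i : Fin (length (map f xs))) →
  ∃ λ y → y ∈ₗ xs × ⋃ (map f xs) ⊆ f y ∪ ⋃ (removeAt (map f xs) i)
                  × (∀ {z} → z ∈ₗ xs → z ≢ y → f z ⊆ ⋃ (removeAt (map f xs) i))
⋃-removeAt-map f (y ∷ xs) zero = y , here refl , ⊆-refl , others
  where
  others : ∀ {z} → z ∈ₗ y ∷ xs → z ≢ y → f z ⊆ ⋃ (map f xs)
  others (here refl)  z≢y = ⊥-elim (z≢y refl)
  others (there z∈xs) _   = λ x∈fz → ∈-⋃⁺ x∈fz (∈-map⁺ f z∈xs)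
⋃-removeAt-map f (x ∷ xs) (suc i) with ⋃-removeAt-map f xs i
... | y , y∈xs , ⋃⊆ , others′ =
  y , there y∈xs , ∪-lub (⊆-∪ʳ (⊆-∪ˡ ⊆-refl)) (⊆-trans ⋃⊆ (∪-lub (⊆-∪ˡ ⊆-refl) (⊆-∪ʳ (⊆-∪ʳ ⊆-refl)))) , others
  where
  others : ∀ {z} → z ∈ₗ x ∷ xs → z ≢ y → f z ⊆ f x ∪ ⋃ (removeAt (map f xs) i)
  others (here refl)  _   = ⊆-∪ˡ ⊆-refl
  others (there z∈xs) z≢y = ⊆-∪ʳ (others′ z∈xs z≢y)

module _ {P : Pred (Fin n) ℓ} (P? : Decidable P) where

  fromDecidable : Subset n
  fromDecidable = Vec.tabulate (does ∘ P?)

  ∈-fromDecidable⁺ : P x → x ∈ fromDecidable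
  ∈-fromDecidable⁺ {x = x} px =
    lookup⇒[]= x fromDecidable (trans (lookup∘tabulate (does ∘ P?) x) (dec-true (P? x) px))

  ∈-fromDecidable⁻ : x ∈ fromDecidable → P x
  ∈-fromDecidable⁻ {x = x} x∈ with P? x | trans (sym (lookup∘tabulate (does ∘ P?) x)) ([]=⇒lookup x∈)
  ... | yes px | _  = px
  ... | no  _  | ()

module _ {m : ℕ} {P : Pred (Fin (suc m)) ℓ} (P? : Decidable P) (P0 : P zero) where

  private
    LastBelow : ℕ → Set ℓ
    LastBelow j = ∃ λ t → P t × ∀ c → t Fin.< c → toℕ c ℕ.< j → ¬ P c

    lastBelow : ∀ j → j ℕ.≤ suc m → LastBelow j
    lastBelow zero    _     = zero , P0 , λ _ _ ()
    lastBelow (suc j) j<1+m with lastBelow j (ℕ.<⇒≤ j<1+m) | P? (fromℕ< j<1+m)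
    ... | _ | yes Pj = fromℕ< j<1+m , Pj , λ c j<c c<1+j _ →
      ℕ.<⇒≱ (subst (ℕ._< toℕ c) (Fin.toℕ-fromℕ< j<1+m) j<c) (ℕ.≤-pred c<1+j)
    ... | t , Pt , above | no ¬Pj = t , Pt , λ c t<c c<1+j →
      [ above c t<c , (λ c≡j → ¬Pj ∘ subst P (Fin.toℕ-injective (trans c≡j (sym (Fin.toℕ-fromℕ< j<1+m))))) ]′
      (ℕ.m<1+n⇒m<n∨m≡n c<1+j)

  lastWitness : ∃ λ t → P t × ∀ c → t Fin.< c → ¬ P c
  lastWitness with lastBelow (suc m) ℕ.≤-refl
  ... | t , Pt , above = t , Pt , λ c t<c → above c t<c (Fin.toℕ<n c)

module MatroidRank (M : Matroid n) where
  open Matroid M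

  Spans : Subset n → Subset n → Set
  Spans X S = rank (X ∪ S) ℕ.≤ rank X

  spans? : ∀ X S → Dec (Spans X S)
  spans? X S = rank (X ∪ S) ≤? rank X

  spans-⊆ : ∀ {X S} → S ⊆ X → Spans X S
  spans-⊆ S⊆X = rank-mono (∪-lub ⊆-refl S⊆X)

  spans-antimono : ∀ {X S S′} → S′ ⊆ S → Spans X S → Spans X S′
  spans-antimono S′⊆S = ℕ.≤-trans (rank-mono (∪-lub (⊆-∪ˡ ⊆-refl) (⊆-∪ʳ S′⊆S)))

  spans-mono : ∀ {X X′ S} → X ⊆ X′ → Spans X S → Spans X′ S
  spans-mono {X} {X′} {S} X⊆X′ XS = ℕ.+-cancelʳ-≤ (rank X) (rank (X′ ∪ S)) (rank X′) (begin
    rank (X′ ∪ S) + rank X                    ≤⟨ ℕ.+-mono-≤ (rank-mono (∪-lub (⊆-∪ˡ ⊆-refl) (⊆-∪ʳ (⊆-∪ʳ ⊆-refl))))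
                                                             (rank-mono (λ x∈X → x∈p∩q⁺ (X⊆X′ x∈X , ⊆-∪ˡ ⊆-refl x∈X))) ⟩
    rank (X′ ∪ (X ∪ S)) + rank (X′ ∩ (X ∪ S)) ≤⟨ rank-submod X′ (X ∪ S) ⟩
    rank X′ + rank (X ∪ S)                    ≤⟨ ℕ.+-monoʳ-≤ (rank X′) XS ⟩
    rank X′ + rank X                          ∎)
    where open ℕ.≤-Reasoning

  spans-trans : ∀ {X Y S} → Spans X Y → Spans Y S → Spans X S
  spans-trans {X} {Y} {S} XY YS = begin
    rank (X ∪ S)       ≤⟨ rank-mono (∪-lub (⊆-∪ˡ (⊆-∪ˡ ⊆-refl)) (⊆-∪ʳ ⊆-refl)) ⟩
    rank ((X ∪ Y) ∪ S) ≤⟨ spans-mono (⊆-∪ʳ ⊆-refl) YS ⟩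
    rank (X ∪ Y)       ≤⟨ XY ⟩
    rank X             ∎
    where open ℕ.≤-Reasoning

  spans-∪ : ∀ {X S S′} → Spans X S → Spans X S′ → Spans X (S ∪ S′)
  spans-∪ {X} {S} {S′} XS XS′ = begin
    rank (X ∪ (S ∪ S′)) ≡⟨ cong rank (sym (∪-assoc X S S′)) ⟩
    rank ((X ∪ S) ∪ S′) ≤⟨ spans-mono (⊆-∪ˡ ⊆-refl) XS′ ⟩
    rank (X ∪ S)        ≤⟨ XS ⟩
    rank X              ∎
    where open ℕ.≤-Reasoning

  spans-⋃ : ∀ {X} {Ss : List (Subset n)} → (∀ {S} → S ∈ₗ Ss → Spans X S) → Spans X (⋃ Ss)
  spans-⋃ {Ss = []}     _   = spans-⊆ (λ x∈⊥ → ⊥-elim (∉⊥ x∈⊥))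
  spans-⋃ {Ss = S ∷ Ss} XSs = spans-∪ (XSs (here refl)) (spans-⋃ (XSs ∘ there))

  spans-pointwise : ∀ {X S} → (∀ {x} → x ∈ S → Spans X ⁅ x ⁆) → Spans X S
  spans-pointwise {X} {S} Xx = spans-antimono S⊆⋃singletons (spans-⋃ X-singletons)
    where
    singletons : List (Subset n)
    singletons = map ⁅_⁆ (filter (_∈? S) (allFin n))

    S⊆⋃singletons : S ⊆ ⋃ singletons
    S⊆⋃singletons {x} x∈S = ∈-⋃⁺ (x∈⁅x⁆ x) (∈-map⁺ ⁅_⁆ (∈-filter⁺ (_∈? S) (∈-allFin x) x∈S))

    X-singletons : ∀ {T} → T ∈ₗ singletons → Spans X T
    X-singletons T∈ with ∈-map⁻ ⁅_⁆ T∈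
    ... | x , x∈ , refl = Xx (proj₂ (∈-filter⁻ (_∈? S) {xs = allFin n} x∈))

  inClosureIn? : ∀ R X (x : Fin n) → Dec (x ∈ R × Spans X ⁅ x ⁆)
  inClosureIn? R X x = x ∈? R ×-dec spans? X ⁅ x ⁆

  closureIn : Subset n → Subset n → Subset n
  closureIn R X = fromDecidable (inClosureIn? R X)

  closureIn⊆ : ∀ {R X} → closureIn R X ⊆ R
  closureIn⊆ {R} {X} = proj₁ ∘ ∈-fromDecidable⁻ (inClosureIn? R X)

  ∈-closureIn : ∀ {R X} → x ∈ R → x ∈ X → x ∈ closureIn R X
  ∈-closureIn {R = R} {X = X} x∈R x∈X =
    ∈-fromDecidable⁺ (inClosureIn? R X) (x∈R , spans-⊆ (λ y∈⁅x⁆ → subst (_∈ X) (sym (x∈⁅y⁆⇒x≡y _ y∈⁅x⁆)) x∈X))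

  spans-closureIn : ∀ R X → Spans X (closureIn R X)
  spans-closureIn R X = spans-pointwise (proj₂ ∘ ∈-fromDecidable⁻ (inClosureIn? R X))

  closureIn-isFlatIn : ∀ R X → IsFlatIn M R (closureIn R X)
  closureIn-isFlatIn R X = closureIn⊆ , λ e e∈R e∉cl r≡ →
    e∉cl (∈-fromDecidable⁺ (inClosureIn? R X) (e∈R , spans-trans (spans-closureIn R X) (ℕ.≤-reflexive r≡)))

  -- If neither A nor B spans R, their closures within R form a vertical cover of M|R.
  round-spans-of-cover : ∀ {R A B} → IsRoundFlat M R → ⊤ ⊆ A ∪ B → ¬ Spans A R → Spans B R
  round-spans-of-cover {R} {A} {B} (_ , noVerticalCover) E⊆A∪B ¬AR with spans? B R
  ... | yes BR = BR
  ... | no ¬BR = ⊥-elim (noVerticalCover (closureIn R A , closureIn R B ,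
          closureIn-isFlatIn R A , closureIn-isFlatIn R B , closureIn≢R ¬AR , closureIn≢R ¬BR ,
          ⊆-antisym (∪-lub closureIn⊆ closureIn⊆) R⊆closures))
    where
    closureIn≢R : ∀ {X} → ¬ Spans X R → closureIn R X ≢ R
    closureIn≢R {X} ¬XR cl≡R = ¬XR (subst (Spans X) cl≡R (spans-closureIn R X))

    R⊆closures : R ⊆ closureIn R A ∪ closureIn R B
    R⊆closures x∈R = x∈p∪q⁺ (⊎-map (∈-closureIn x∈R) (∈-closureIn x∈R) (x∈p∪q⁻ A B (E⊆A∪B ∈⊤)))

  complementRankSum : Subset n → List (Subset n) → ℕ
  complementRankSum T Fs = sum (map (λ i → rank (T ∪ ⋃ (removeAt Fs i))) (allFin (length Fs)))

  complementRankSum-∷ : ∀ T F Fs →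
    complementRankSum T (F ∷ Fs) ≡ rank (T ∪ ⋃ Fs) + complementRankSum (T ∪ F) Fs
  complementRankSum-∷ T F Fs = cong (λ s → rank (T ∪ ⋃ Fs) + s) (cong sum (begin
    map term (tabulate suc)                                 ≡⟨ List.map-tabulate suc term ⟩
    tabulate (term ∘ suc)                                   ≡⟨ List.tabulate-cong (λ i → cong rank (sym (∪-assoc T F _))) ⟩
    tabulate (λ i → rank ((T ∪ F) ∪ ⋃ (removeAt Fs i)))     ≡⟨ List.map-tabulate (λ i → i) _ ⟨
    map (λ i → rank ((T ∪ F) ∪ ⋃ (removeAt Fs i))) (allFin (length Fs)) ∎))
    where
    open ≡-Reasoning
    term : Fin (suc (length Fs)) → ℕ
    term i = rank (T ∪ ⋃ (removeAt (F ∷ Fs) i))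

  submod-cover : ∀ {R X Y W} → ⊤ ⊆ X ∪ Y → Spans X R → W ⊆ X → W ⊆ Y →
                 rank ⊤ + rank (W ∪ R) ℕ.≤ rank X + rank (Y ∪ R)
  submod-cover {R} {X} {Y} {W} E⊆X∪Y XR W⊆X W⊆Y = begin
    rank ⊤ + rank (W ∪ R)                             ≤⟨ ℕ.+-mono-≤ (rank-mono E⊆) (rank-mono W∪R⊆) ⟩
    rank ((X ∪ R) ∪ (Y ∪ R)) + rank ((X ∪ R) ∩ (Y ∪ R)) ≤⟨ rank-submod (X ∪ R) (Y ∪ R) ⟩
    rank (X ∪ R) + rank (Y ∪ R)                       ≤⟨ ℕ.+-monoˡ-≤ (rank (Y ∪ R)) XR ⟩
    rank X + rank (Y ∪ R)                             ∎
    where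
    open ℕ.≤-Reasoning
    E⊆ : ⊤ ⊆ (X ∪ R) ∪ (Y ∪ R)
    E⊆ = ⊆-trans E⊆X∪Y (∪-lub (⊆-∪ˡ (⊆-∪ˡ ⊆-refl)) (⊆-∪ʳ (⊆-∪ˡ ⊆-refl)))
    W∪R⊆ : W ∪ R ⊆ (X ∪ R) ∩ (Y ∪ R)
    W∪R⊆ = ∪-lub (λ x∈W → x∈p∩q⁺ (⊆-∪ˡ W⊆X x∈W , ⊆-∪ˡ W⊆Y x∈W))
                 (λ x∈R → x∈p∩q⁺ (⊆-∪ʳ ⊆-refl x∈R , ⊆-∪ʳ ⊆-refl x∈R))

  complementRankSum-bound : ∀ R T Fs → ⊤ ⊆ T ∪ ⋃ Fs → (∀ i → Spans (T ∪ ⋃ (removeAt Fs i)) R) →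
    rank (T ∪ R) + length Fs * rank ⊤ ℕ.≤ complementRankSum T Fs + rank ⊤
  complementRankSum-bound R T [] _ _ = begin
    rank (T ∪ R) + 0 ≡⟨ ℕ.+-identityʳ _ ⟩
    rank (T ∪ R)     ≤⟨ rank-mono (λ _ → ∈⊤) ⟩
    rank ⊤           ∎
    where open ℕ.≤-Reasoning
  complementRankSum-bound R T (F ∷ Fs) E⊆ complementsSpan = begin
    rTR + (rE + d * rE)    ≡⟨ ℕ.+-assoc rTR rE (d * rE) ⟨
    (rTR + rE) + d * rE    ≡⟨ cong (_+ d * rE) (ℕ.+-comm rTR rE) ⟩
    (rE + rTR) + d * rE    ≤⟨ ℕ.+-monoˡ-≤ (d * rE) first ⟩
    (rX + rYR) + d * rE    ≡⟨ ℕ.+-assoc rX rYR (d * rE) ⟩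
    rX + (rYR + d * rE)    ≤⟨ ℕ.+-monoʳ-≤ rX rest ⟩
    rX + (σ + rE)          ≡⟨ ℕ.+-assoc rX σ rE ⟨
    (rX + σ) + rE          ≡⟨ cong (_+ rE) (complementRankSum-∷ T F Fs) ⟨
    complementRankSum T (F ∷ Fs) + rE ∎
    where
    open ℕ.≤-Reasoning
    rTR rE d rX rYR σ : ℕ
    rTR = rank (T ∪ R)
    rE  = rank ⊤
    d   = length Fs
    rX  = rank (T ∪ ⋃ Fs)
    rYR = rank ((T ∪ F) ∪ R)
    σ   = complementRankSum (T ∪ F) Fs

    first : rE + rTR ℕ.≤ rX + rYR
    first = submod-cover E⊆X∪Y (complementsSpan zero) (⊆-∪ˡ ⊆-refl) (⊆-∪ˡ ⊆-refl)
      where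
      E⊆X∪Y : ⊤ ⊆ (T ∪ ⋃ Fs) ∪ (T ∪ F)
      E⊆X∪Y = ⊆-trans E⊆ (∪-lub (⊆-∪ˡ (⊆-∪ˡ ⊆-refl)) (∪-lub (⊆-∪ʳ (⊆-∪ʳ ⊆-refl)) (⊆-∪ˡ (⊆-∪ʳ ⊆-refl))))

    rest : rYR + d * rE ℕ.≤ σ + rE
    rest = complementRankSum-bound R (T ∪ F) Fs
      (λ x∈⊤ → subst (_ ∈_) (sym (∪-assoc T F (⋃ Fs))) (E⊆ x∈⊤))
      (λ i → subst (λ X → Spans X R) (sym (∪-assoc T F _)) (complementsSpan (suc i)))

m+n*k≤o+k⇒m≤o-[n-1]*k : ∀ m n k o → m + n * k ℕ.≤ o + k → + m ℤ.≤ + o ℤ.- ((+ n ℤ.- + 1) ℤ.* + k)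
m+n*k≤o+k⇒m≤o-[n-1]*k m n k o m+nk≤o+k = begin
  + m                                ≡⟨ cancel (+ m) (+ (n * k)) ⟩
  (+ m ℤ.+ + (n * k)) ℤ.- + (n * k)  ≡⟨ cong (ℤ._- + (n * k)) (ℤ.pos-+ m (n * k)) ⟨
  + (m + n * k) ℤ.- + (n * k)        ≤⟨ ℤ.+-monoˡ-≤ (ℤ.- + (n * k)) (+≤+ m+nk≤o+k) ⟩
  + (o + k) ℤ.- + (n * k)            ≡⟨ cong₂ ℤ._-_ (ℤ.pos-+ o k) (ℤ.pos-* n k) ⟩
  (+ o ℤ.+ + k) ℤ.- + n ℤ.* + k      ≡⟨ regroup (+ o) (+ n) (+ k) ⟩
  + o ℤ.- ((+ n ℤ.- + 1) ℤ.* + k)    ∎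
  where
  open ℤ.≤-Reasoning
  cancel : ∀ i j → i ≡ (i ℤ.+ j) ℤ.- j
  cancel = solve-∀
  regroup : ∀ i j l → (i ℤ.+ l) ℤ.- j ℤ.* l ≡ i ℤ.- ((j ℤ.- ℤ.1ℤ) ℤ.* l)
  regroup = solve-∀

nodeWidth≤width : ∀ (M : Matroid n) (D : TreeDecomposition n) t → nodeWidth M D t ℤ.≤ width M D
nodeWidth≤width M D t = ≤-foldr (TreeDecomposition.nodes D) (∈-allFin t)
  where
  ≤-foldr : ∀ ts → t ∈ₗ ts → nodeWidth M D t ℤ.≤ foldr (λ s w → nodeWidth M D s ℤ.⊔ w) (nodeWidth M D zero) ts
  ≤-foldr (_ ∷ _)  (here refl)  = ℤ.i≤i⊔j _ _
  ≤-foldr (_ ∷ ts) (there t∈ts) = ℤ.≤-trans (≤-foldr ts t∈ts) (ℤ.i≤j⊔i _ _)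

module TreeStructure (D : TreeDecomposition n) where
  open TreeDecomposition D
  open DecMembership (_≟_ {suc m}) using () renaming (_∈?_ to _∈ₗ?_; _∉?_ to _∉ₗ?_)

  ∈-ancestorsF-self : ∀ f s → s ∈ₗ ancestorsF f s
  ∈-ancestorsF-self zero    s       = here refl
  ∈-ancestorsF-self (suc f) zero    = here refl
  ∈-ancestorsF-self (suc f) (suc i) = here refl

  zero∈ancestorsF : ∀ f s → toℕ s ℕ.≤ f → zero ∈ₗ ancestorsF f s
  zero∈ancestorsF zero    zero    _         = here refl
  zero∈ancestorsF (suc f) zero    _         = here refl
  zero∈ancestorsF (suc f) (suc i) (s≤s i≤f) =
    there (zero∈ancestorsF f (parent i) (ℕ.≤-trans (parent-lt i) i≤f))

  parent∈ancestorsF : ∀ f j → toℕ (suc j) ℕ.≤ f → parent j ∈ₗ ancestorsF f (suc j)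
  parent∈ancestorsF (suc f) j _ = there (∈-ancestorsF-self f (parent j))

  ancestorsF-edge : ∀ f s t → t ∈ₗ ancestorsF f s → s ≢ t → ∃ λ j → parent j ≡ t × suc j ∈ₗ ancestorsF f s
  ancestorsF-edge zero    s       _ (here refl) s≢t = ⊥-elim (s≢t refl)
  ancestorsF-edge (suc f) zero    _ (here refl) s≢t = ⊥-elim (s≢t refl)
  ancestorsF-edge (suc f) (suc i) _ (here refl) s≢t = ⊥-elim (s≢t refl)
  ancestorsF-edge (suc f) (suc i) t (there t∈) _ with parent i ≟ t
  ... | yes pi≡t = i , pi≡t , here refl
  ... | no  pi≢t with ancestorsF-edge f (parent i) t t∈ pi≢t
  ...   | j , pj≡t , j∈ = j , pj≡t , there j∈

  zero∈ancestors : ∀ s → zero ∈ₗ ancestors s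
  zero∈ancestors s = zero∈ancestorsF m s (Fin.toℕ≤pred[n] s)

  ∈-children⁺ : ∀ {j t} → parent j ≡ t → suc j ∈ₗ children t
  ∈-children⁺ {j} {t} pj≡t = ∈-map⁺ suc (∈-filter⁺ (λ i → parent i ≟ t) (∈-allFin j) pj≡t)

  ∈-children⁻ : ∀ {c t} → c ∈ₗ children t → ∃ λ j → c ≡ suc j × parent j ≡ t
  ∈-children⁻ {t = t} c∈ with ∈-map⁻ suc c∈
  ... | j , j∈ , refl = j , refl , proj₂ (∈-filter⁻ (λ i → parent i ≟ t) {xs = allFin m} j∈)

  children-above : ∀ {c t} → c ∈ₗ children t → t Fin.< c
  children-above c∈ with ∈-children⁻ c∈
  ... | j , refl , refl = s≤s (parent-lt j)

  ∈-subtree⁺ : ∀ {c s} → c ∈ₗ ancestors s → s ∈ₗ subtree c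
  ∈-subtree⁺ {c} {s} c∈ = ∈-filter⁺ (λ s → c ∈ₗ? ancestors s) (∈-allFin s) c∈

  ∈-subtree⁻ : ∀ {c s} → s ∈ₗ subtree c → c ∈ₗ ancestors s
  ∈-subtree⁻ {c} s∈ = proj₂ (∈-filter⁻ (λ s → c ∈ₗ? ancestors s) {xs = nodes} s∈)

  ∈-subtree-child : ∀ {s t} → t ∈ₗ ancestors s → s ≢ t → ∃ λ c → c ∈ₗ children t × s ∈ₗ subtree c
  ∈-subtree-child {s} {t} t∈ s≢t with ancestorsF-edge m s t t∈ s≢t
  ... | j , pj≡t , j∈ = suc j , ∈-children⁺ pj≡t , ∈-subtree⁺ j∈

  subtree-child≢upper : ∀ {c t} → c ∈ₗ children t → subtree c ≢ upper t
  subtree-child≢upper {t = t} c∈ subtree≡upper with ∈-children⁻ c∈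
  ... | j , refl , pj≡t = t∉ (subst (_∈ₗ ancestors (suc j)) pj≡t
                                   (parent∈ancestorsF m j (Fin.toℕ≤pred[n] (suc j))))
    where
    t∉ : t ∉ₗ ancestors (suc j)
    t∉ = proj₂ (∈-filter⁻ (λ s → t ∉ₗ? ancestors s) {xs = nodes}
           (subst (suc j ∈ₗ_) subtree≡upper (∈-subtree⁺ (∈-ancestorsF-self m (suc j)))))

  ∈-components : ∀ {s} t → s ≢ t → ∃ λ C → C ∈ₗ components t × s ∈ₗ C
  ∈-components {s} zero s≢t with ∈-subtree-child (zero∈ancestors s) s≢t
  ... | c , c∈ , s∈ = subtree c , ∈-map⁺ subtree c∈ , s∈
  ∈-components {s} (suc i) s≢t with suc i ∈ₗ? ancestors s
  ... | yes t∈ = let c , c∈ , s∈ = ∈-subtree-child t∈ s≢t in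
                 subtree c , ∈-++⁺ˡ (∈-map⁺ subtree c∈) , s∈
  ... | no  t∉ = upper (suc i) , ∈-++⁺ʳ (map subtree (children (suc i))) (here refl) ,
                 ∈-filter⁺ (λ s → suc i ∉ₗ? ancestors s) (∈-allFin s) t∉

  subtree-child∈components : ∀ {c} t → c ∈ₗ children t → subtree c ∈ₗ components t
  subtree-child∈components zero    c∈ = ∈-map⁺ subtree c∈
  subtree-child∈components (suc i) c∈ = ∈-++⁺ˡ (∈-map⁺ subtree c∈)

  data ComponentOf (t : Node) : List Node → Set where
    below : ∀ {c} → c ∈ₗ children t → ComponentOf t (subtree c)
    above : ComponentOf t (upper t)

  componentOf : ∀ {t C} → C ∈ₗ components t → ComponentOf t C
  componentOf {zero} C∈ with ∈-map⁻ subtree C∈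
  ... | c , c∈ , refl = below c∈
  componentOf {suc i} C∈ with ∈-++⁻ (map subtree (children (suc i))) C∈
  ... | inj₁ C∈′ with ∈-map⁻ subtree C∈′
  ...   | c , c∈ , refl = below c∈
  componentOf {suc i} C∈ | inj₂ (here refl) = above

module SpanningNodes (M : Matroid n) (D : TreeDecomposition n) {R : Subset n} (round : IsRoundFlat M R) where
  open Matroid M
  open TreeDecomposition D
  open MatroidRank M
  open TreeStructure D

  elementsOf : List Node → Subset n
  elementsOf C = ⋃ (map τ C)

  τ⊆elementsOf : ∀ {s C} → s ∈ₗ C → τ s ⊆ elementsOf C
  τ⊆elementsOf s∈C x∈τs = ∈-⋃⁺ x∈τs (∈-map⁺ τ s∈C)

  Spanning : Node → Set
  Spanning c = Spans (elementsOf (subtree c)) R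

  spanning? : Decidable Spanning
  spanning? c = spans? (elementsOf (subtree c)) R

  root-spanning : Spanning zero
  root-spanning = spans-⊆ λ {e} _ → let s , e∈τs = covers e in
    τ⊆elementsOf (∈-subtree⁺ (zero∈ancestors s)) e∈τs

  ⊤⊆τ∪bags : ∀ t → ⊤ ⊆ τ t ∪ ⋃ (bags t)
  ⊤⊆τ∪bags t {e} _ with covers e
  ... | s , e∈τs with s ≟ t
  ...   | yes refl = ⊆-∪ˡ ⊆-refl e∈τs
  ...   | no  s≢t with ∈-components t s≢t
  ...     | C , C∈ , s∈C = ⊆-∪ʳ (λ x∈ → ∈-⋃⁺ x∈ (∈-map⁺ elementsOf C∈)) (τ⊆elementsOf s∈C e∈τs)

  complements-span : ∀ t → Spanning t → (∀ {c} → c ∈ₗ children t → ¬ Spanning c) →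
                     ∀ i → Spans (τ t ∪ ⋃ (removeAt (bags t) i)) R
  complements-span t spanning-t children-not-spanning i with ⋃-removeAt-map elementsOf (components t) i
  ... | C , C∈ , ⋃⊆ , others with componentOf C∈
  ... | below {c} c∈ = round-spans-of-cover round E⊆ (children-not-spanning c∈)
    where
    E⊆ : ⊤ ⊆ elementsOf (subtree c) ∪ (τ t ∪ ⋃ (removeAt (bags t) i))
    E⊆ = ⊆-trans (⊤⊆τ∪bags t)
           (∪-lub (⊆-∪ʳ (⊆-∪ˡ ⊆-refl)) (⊆-trans ⋃⊆ (∪-lub (⊆-∪ˡ ⊆-refl) (⊆-∪ʳ (⊆-∪ʳ ⊆-refl)))))
  ... | above = spans-mono subtree⊆ spanning-t
    where
    subtree⊆ : elementsOf (subtree t) ⊆ τ t ∪ ⋃ (removeAt (bags t) i)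
    subtree⊆ x∈ with ∈-⋃⁻ (map τ (subtree t)) x∈
    ... | S , S∈ , x∈S with ∈-map⁻ τ S∈
    ... | s , s∈ , refl with s ≟ t
    ...   | yes refl = ⊆-∪ˡ ⊆-refl x∈S
    ...   | no  s≢t with ∈-subtree-child (∈-subtree⁻ s∈) s≢t
    ...     | c , c∈ , s∈c = ⊆-∪ʳ ⊆-refl
      (others (subtree-child∈components t c∈) (subtree-child≢upper c∈) (τ⊆elementsOf s∈c x∈S))

  rank≤nodeWidth : ∀ t → Spanning t → (∀ {c} → c ∈ₗ children t → ¬ Spanning c) → + rank R ℤ.≤ nodeWidth M D t
  rank≤nodeWidth t spanning-t children-not-spanning =
    m+n*k≤o+k⇒m≤o-[n-1]*k (rank R) (length (bags t)) (rank ⊤) (complementRankSum (τ t) (bags t))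
      (ℕ.≤-trans (ℕ.+-monoˡ-≤ (length (bags t) * rank ⊤) (rank-mono (⊆-∪ʳ ⊆-refl)))
        (complementRankSum-bound R (τ t) (bags t) (⊤⊆τ∪bags t)
          (complements-span t spanning-t children-not-spanning)))

mainTheorem16 : ∀ {n : ℕ} (M : Matroid n) (R : Subset n) → IsRoundFlat M R →
    (D : TreeDecomposition n) → + Matroid.rank M R ≤ width M D
mainTheorem16 M R round D =
  let t , spanning-t , nothing-above = lastWitness spanning? root-spanning in
  ℤ.≤-trans (rank≤nodeWidth t spanning-t (λ c∈ → nothing-above _ (children-above c∈))) (nodeWidth≤width M D t)
  where
  open SpanningNodes M D round
  open TreeStructure D using (children-above)
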